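{- Let $(a_n)_{n\ge1}$ be an E-sequence such that (i) $3^n>2^{b_n}$ for all $n\ge1$, where $b_n=\sum_{i=1}^na_i$; and (ii) there is a constant $c>\log_2 3$ such that there are infinitely many distinct pairs $(r,l)$ of positive integers with $l>r$, $b_{l+r}>lc$, and $a_{l+k}=a_k$ for all $1\le k\le r$. Then $(a_n)$ is $\Omega$-divergent.
   Context: An E-sequence is any infinite sequence $(a_n)_{n\ge1}$ of positive integers. For an odd positive integer $x$, its E-sequence is defined by $x_0=x$ and, for $n\ge1$, $x_n=\frac{3x_{n-1}+1}{2^{a_n}}$, where $a_n$ is the exponent of the largest power of $2$ dividing $3x_{n-1}+1$. An E-sequence is $\Omega$-divergent if it is not the E-sequence of any odd positive integer.
   Formalization: The constant $c>\log_2 3$ in hypothesis (ii) ranges only over the rationals. -}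

module Defs where

open import Data.Nat using (ℕ; zero; suc; _+_; _*_; _^_; _≤_; _<_)
open import Data.Nat.DivMod using (_/_)
open import Data.Nat.Properties using (m^n≢0)
open import Data.Nat.Divisibility using (_∣_)
open import Data.Product using (_×_; Σ; ∃; _,_)
open import Data.List using (List)
open import Data.List.Membership.Propositional using (_∉_)
open import Relation.Nullary using (¬_)

-- An E-sequence is an infinite sequence (a_n)_{n≥1} of positive integers.
-- We represent it by a : ℕ → ℕ, using only the values a n for n ≥ 1
-- (a 0 is ignored).
IsESequence : (ℕ → ℕ) → Set
IsESequence a = ∀ n → 1 ≤ n → 1 ≤ a n

b : (ℕ → ℕ) → ℕ → ℕ
b a zero    = 0
b a (suc n) = b a n + a (suc n)

Odd : ℕ → Set
Odd x = ¬ (2 ∣ x)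

traj : (ℕ → ℕ) → ℕ → ℕ → ℕ
traj a x zero    = x
traj a x (suc n) = _/_ (3 * traj a x n + 1) (2 ^ a (suc n)) {{m^n≢0 2 (a (suc n))}}

IsESequenceOf : ℕ → (ℕ → ℕ) → Set
IsESequenceOf x a =
  ∀ n → (2 ^ a (suc n) ∣ 3 * traj a x n + 1)
      × ¬ (2 ^ (a (suc n) + 1) ∣ 3 * traj a x n + 1)

ΩDivergent : (ℕ → ℕ) → Set
ΩDivergent a = ¬ (Σ ℕ λ x → (0 < x) × Odd x × IsESequenceOf x a)

-- The pair (r , l) satisfies the conditions of (ii) for the constant c = p / q:
-- r ≥ 1, l > r, b_{l+r} > l·(p/q) (i.e. q·b_{l+r} > l·p), and a_{l+k} = a_k for 1 ≤ k ≤ r.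
GoodPair : (ℕ → ℕ) → ℕ → ℕ → ℕ × ℕ → Set
GoodPair a p q (r , l) =
  1 ≤ r × r < l × l * p < q * b a (l + r)
  × (∀ k → 1 ≤ k → k ≤ r → a (l + k) ≡ a k)
  where open import Relation.Binary.PropositionalEquality using (_≡_)

InfinitelyManyGoodPairs : (ℕ → ℕ) → ℕ → ℕ → Set
InfinitelyManyGoodPairs a p q =
  (L : List (ℕ × ℕ)) → Σ (ℕ × ℕ) λ rl → GoodPair a p q rl × rl ∉ L

module Submission where

-- Suppose (a_n) were the E-sequence of an odd x ≥ 1, with trajectory x_n.
--  (1) Unrolling x_n = (3 x_{n-1} + 1) / 2^{a_n} gives 2^{b_n} x_n = 3^n x + c_n, where
--      c_n ≤ n·3^n because 2^{b_k} ≤ 3^k; by hypothesis (i) also x_l > x for l ≥ 1.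
--  (2) If a_{l+k} = a_k for 1 ≤ k ≤ r, the trajectory of x_l repeats the first r steps of
--      that of x, so 2^{b_r} divides 3^r (x_l − x), hence x_l − x, hence 2^{b_r} ≤ x_l;
--      therefore 2^{b_{l+r}} = 2^{b_l} 2^{b_r} ≤ 2^{b_l} x_l ≤ 3^l (x + l).
--  (3) For c = p/q, a good pair (r , l) gives 2^{pl} < 2^{q b_{l+r}} ≤ 3^{ql} (x + l)^q,
--      so (3^q + 1)^l < (3^q)^l (x + l)^q because 3^q < 2^p.
--  (4) An exponential beats a polynomial: T^l (K + l)^q < (T + 1)^l for all large l,
--      while infinitely many good pairs force arbitrarily large l, contradicting (3).

open import Defs
open import Data.Nat
open import Data.Nat.Properties
open import Data.Nat.DivMod using (_/_; m*[n/m]≡n)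
open import Data.Nat.Divisibility
open import Data.Nat.Primality using (Prime; prime?; euclidsLemma)
open import Data.Nat.Tactic.RingSolver using (solve-∀)
open import Data.Product using (_×_; Σ; ∃; _,_; proj₁)
open import Data.Sum using (inj₁; inj₂; [_,_]′)
open import Data.Empty using (⊥-elim)
open import Data.List using (cartesianProduct; upTo)
open import Data.List.Membership.Propositional.Properties using (∈-cartesianProduct⁺; ∈-upTo⁺)
open import Relation.Binary.PropositionalEquality
open import Relation.Nullary using (¬_; yes; no)
open import Relation.Nullary.Decidable using (from-yes; from-no)

collatzStep : ℕ → ℕ → ℕ
collatzStep t e = _/_ (3 * t + 1) (2 ^ e) {{m^n≢0 2 e}}

ExactSteps : (ℕ → ℕ) → ℕ → ℕ → Set
ExactSteps a y n = ∀ k → k < n → 2 ^ a (suc k) ∣ 3 * traj a y k + 1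

-- The constant c_n of the affine relation 2^{b_n} x_n = 3^n x_0 + c_n.
offset : (ℕ → ℕ) → ℕ → ℕ
offset a zero    = 0
offset a (suc n) = 3 * offset a n + 2 ^ b a n

traj-affine : ∀ a y n → ExactSteps a y n → 2 ^ b a n * traj a y n ≡ 3 ^ n * y + offset a n
traj-affine a y zero    _     = sym (+-identityʳ (1 * y))
traj-affine a y (suc n) exact = begin
    2 ^ (b a n + a (suc n)) * collatzStep t (a (suc n))
  ≡⟨ cong (_* collatzStep t (a (suc n))) (^-distribˡ-+-* 2 (b a n) (a (suc n))) ⟩
    2 ^ b a n * 2 ^ a (suc n) * collatzStep t (a (suc n))
  ≡⟨ *-assoc (2 ^ b a n) (2 ^ a (suc n)) (collatzStep t (a (suc n))) ⟩
    2 ^ b a n * (2 ^ a (suc n) * collatzStep t (a (suc n)))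
  ≡⟨ cong (2 ^ b a n *_) (m*[n/m]≡n {{m^n≢0 2 (a (suc n))}} (exact n (n<1+n n))) ⟩
    2 ^ b a n * (3 * t + 1)
  ≡⟨ distribute (2 ^ b a n) t ⟩
    3 * (2 ^ b a n * t) + 2 ^ b a n
  ≡⟨ cong (λ v → 3 * v + 2 ^ b a n) (traj-affine a y n (λ k k<n → exact k (m<n⇒m<1+n k<n))) ⟩
    3 * (3 ^ n * y + offset a n) + 2 ^ b a n
  ≡⟨ regroup (3 ^ n) y (offset a n) (2 ^ b a n) ⟩
    3 ^ suc n * y + offset a (suc n)
  ∎
  where
  open ≡-Reasoning
  t = traj a y n
  distribute : ∀ P t → P * (3 * t + 1) ≡ 3 * (P * t) + P
  distribute = solve-∀
  regroup : ∀ T y C P → 3 * (T * y + C) + P ≡ 3 * T * y + (3 * C + P)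
  regroup = solve-∀

offset-bound : ∀ a → (∀ k → 2 ^ b a k ≤ 3 ^ k) → ∀ n → offset a n ≤ n * 3 ^ n
offset-bound a sub zero    = ≤-refl
offset-bound a sub (suc n) = begin
    3 * offset a n + 2 ^ b a n
  ≤⟨ +-mono-≤ (*-monoʳ-≤ 3 (offset-bound a sub n)) (sub n) ⟩
    3 * (n * 3 ^ n) + 3 ^ n
  ≤⟨ m≤m+n _ (2 * 3 ^ n) ⟩
    3 * (n * 3 ^ n) + 3 ^ n + 2 * 3 ^ n
  ≡⟨ regroup n (3 ^ n) ⟩
    suc n * 3 ^ suc n
  ∎
  where
  open ≤-Reasoning
  regroup : ∀ n T → 3 * (n * T) + T + 2 * T ≡ suc n * (3 * T)
  regroup = solve-∀

traj-grows : ∀ a y l → ExactSteps a y l → 2 ^ b a l < 3 ^ l → 1 ≤ y → y < traj a y l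
traj-grows a y l exact sub y≥1 = *-cancelˡ-< (2 ^ b a l) y (traj a y l) (begin-strict
    2 ^ b a l * y          <⟨ *-monoˡ-< y {{>-nonZero y≥1}} sub ⟩
    3 ^ l * y              ≤⟨ m≤m+n (3 ^ l * y) (offset a l) ⟩
    3 ^ l * y + offset a l ≡⟨ traj-affine a y l exact ⟨
    2 ^ b a l * traj a y l ∎)
  where open ≤-Reasoning

two-prime : Prime 2
two-prime = from-yes (prime? 2)

three-pow-odd : ∀ r → ¬ 2 ∣ 3 ^ r
three-pow-odd zero    = from-no (2 ∣? 1)
three-pow-odd (suc r) 2∣3^[1+r] =
  [ from-no (2 ∣? 3) , three-pow-odd r ]′ (euclidsLemma 3 (3 ^ r) two-prime 2∣3^[1+r])

odd-cancel : ∀ {u m} k → ¬ 2 ∣ u → 2 ^ k ∣ u * m → 2 ^ k ∣ m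
odd-cancel zero _ _ = 1∣ _
odd-cancel {u} {m} (suc k) u-odd 2^[1+k]∣um
  with euclidsLemma u m two-prime (∣-trans (m∣m*n (2 ^ k)) 2^[1+k]∣um)
... | inj₁ 2∣u = ⊥-elim (u-odd 2∣u)
... | inj₂ (divides m′ refl) =
  subst (2 * 2 ^ k ∣_) (*-comm 2 m′) (*-monoʳ-∣ 2 (odd-cancel k u-odd 2^k∣um′))
  where
  move-two : ∀ u m′ → u * (m′ * 2) ≡ 2 * (u * m′)
  move-two = solve-∀
  2^k∣um′ : 2 ^ k ∣ u * m′
  2^k∣um′ = *-cancelˡ-∣ 2 (subst (2 * 2 ^ k ∣_) (move-two u m′) 2^[1+k]∣um)

-- Two starting points whose first n steps are exact for the same sequence are
-- congruent modulo 2^{b_n}: 2^{b_n} divides 3^n times their difference, and 3^n is odd.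
congruence : ∀ a y d n → ExactSteps a y n → ExactSteps a (y + d) n → 2 ^ b a n ∣ d
congruence a y d n exact-y exact-yd =
  odd-cancel (b a n) (three-pow-odd n) (∣m+n∣m⇒∣n divides-sum (m∣m*n (traj a y n)))
  where
  open ≡-Reasoning
  difference : 2 ^ b a n * traj a (y + d) n ≡ 2 ^ b a n * traj a y n + 3 ^ n * d
  difference = begin
      2 ^ b a n * traj a (y + d) n  ≡⟨ traj-affine a (y + d) n exact-yd ⟩
      3 ^ n * (y + d) + offset a n  ≡⟨ regroup (3 ^ n) y d (offset a n) ⟩
      3 ^ n * y + offset a n + 3 ^ n * d
        ≡⟨ cong (_+ 3 ^ n * d) (traj-affine a y n exact-y) ⟨
      2 ^ b a n * traj a y n + 3 ^ n * d ∎
    where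
    regroup : ∀ T y d C → T * (y + d) + C ≡ T * y + C + T * d
    regroup = solve-∀
  divides-sum : 2 ^ b a n ∣ 2 ^ b a n * traj a y n + 3 ^ n * d
  divides-sum = subst (2 ^ b a n ∣_) difference (m∣m*n (traj a (y + d) n))

Repeats : (ℕ → ℕ) → ℕ → ℕ → Set
Repeats a l r = ∀ k → 1 ≤ k → k ≤ r → a (l + k) ≡ a k

repeats-≤ : ∀ {a l k r} → k ≤ r → Repeats a l r → Repeats a l k
repeats-≤ k≤r rep i 1≤i i≤k = rep i 1≤i (≤-trans i≤k k≤r)

repeats-last : ∀ {a l r} → Repeats a l (suc r) → a (suc (l + r)) ≡ a (suc r)
repeats-last {a} {l} {r} rep = trans (cong a (sym (+-suc l r))) (rep (suc r) (s≤s z≤n) ≤-refl)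

b-window : ∀ a l r → Repeats a l r → b a (l + r) ≡ b a l + b a r
b-window a l zero    _   = trans (cong (b a) (+-identityʳ l)) (sym (+-identityʳ (b a l)))
b-window a l (suc r) rep = begin
    b a (l + suc r)                ≡⟨ cong (b a) (+-suc l r) ⟩
    b a (l + r) + a (suc (l + r))
      ≡⟨ cong₂ _+_ (b-window a l r (repeats-≤ (n≤1+n r) rep)) (repeats-last rep) ⟩
    b a l + b a r + a (suc r)      ≡⟨ +-assoc (b a l) (b a r) (a (suc r)) ⟩
    b a l + b a (suc r)            ∎
  where open ≡-Reasoning

traj-window : ∀ a y l k → Repeats a l k → traj a y (l + k) ≡ traj a (traj a y l) k
traj-window a y l zero    _   = cong (traj a y) (+-identityʳ l)
traj-window a y l (suc k) rep = begin
    traj a y (l + suc k)                            ≡⟨ cong (traj a y) (+-suc l k) ⟩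
    collatzStep (traj a y (l + k)) (a (suc (l + k)))
      ≡⟨ cong₂ collatzStep (traj-window a y l k (repeats-≤ (n≤1+n k) rep)) (repeats-last rep) ⟩
    traj a (traj a y l) (suc k)                     ∎
  where open ≡-Reasoning

exact-window : ∀ a y l r → ExactSteps a y (l + r) → Repeats a l r → ExactSteps a (traj a y l) r
exact-window a y l r exact rep k k<r =
  subst₂ (λ e t → 2 ^ e ∣ 3 * t + 1)
    (repeats-last (repeats-≤ k<r rep))
    (traj-window a y l k (repeats-≤ (<⇒≤ k<r) rep))
    (exact (l + k) (+-monoʳ-< l k<r))

window-bound : ∀ a y l r → (∀ n → ExactSteps a y n) → (∀ k → 2 ^ b a k ≤ 3 ^ k)
             → 2 ^ b a l < 3 ^ l → 1 ≤ y → Repeats a l r → 2 ^ b a (l + r) ≤ 3 ^ l * (y + l)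
window-bound a y l r exact sub sub-l y≥1 rep
  with m≤n⇒∃[o]m+o≡n (traj-grows a y l (exact l) sub-l y≥1)
... | e , 1+y+e≡z = begin
    2 ^ b a (l + r)             ≡⟨ cong (2 ^_) (b-window a l r rep) ⟩
    2 ^ (b a l + b a r)         ≡⟨ ^-distribˡ-+-* 2 (b a l) (b a r) ⟩
    2 ^ b a l * 2 ^ b a r       ≤⟨ *-monoʳ-≤ (2 ^ b a l) 2^br≤z ⟩
    2 ^ b a l * z               ≡⟨ traj-affine a y l (exact l) ⟩
    3 ^ l * y + offset a l      ≤⟨ +-monoʳ-≤ (3 ^ l * y) (offset-bound a sub l) ⟩
    3 ^ l * y + l * 3 ^ l       ≡⟨ cong (3 ^ l * y +_) (*-comm l (3 ^ l)) ⟩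
    3 ^ l * y + 3 ^ l * l       ≡⟨ *-distribˡ-+ (3 ^ l) y l ⟨
    3 ^ l * (y + l)             ∎
  where
  open ≤-Reasoning
  z = traj a y l
  z≡y+d : z ≡ y + suc e
  z≡y+d = sym (trans (+-suc y e) 1+y+e≡z)
  exact-z : ExactSteps a (y + suc e) r
  exact-z = subst (λ w → ExactSteps a w r) z≡y+d (exact-window a y l r (exact (l + r)) rep)
  2^br≤z : 2 ^ b a r ≤ z
  2^br≤z = begin
    2 ^ b a r  ≤⟨ ∣⇒≤ (congruence a y (suc e) r (exact r) exact-z) ⟩
    suc e      ≤⟨ m≤n+m (suc e) y ⟩
    y + suc e  ≡⟨ z≡y+d ⟨
    z          ∎

^-distribʳ-* : ∀ m n j → (m * n) ^ j ≡ m ^ j * n ^ j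
^-distribʳ-* m n zero    = refl
^-distribʳ-* m n (suc j) = trans (cong (m * n *_) (^-distribʳ-* m n j)) (interchange m n (m ^ j) (n ^ j))
  where
  interchange : ∀ m n x y → m * n * (x * y) ≡ m * x * (n * y)
  interchange = solve-∀

-- Bernoulli's inequality (1 + 1/A)^j ≥ 1 + j/A, cleared of denominators.
bernoulli : ∀ A j → A ^ j * (A + j) ≤ A * suc A ^ j
bernoulli A zero    = ≤-reflexive (trans (*-identityˡ (A + 0)) (trans (+-identityʳ A) (sym (*-identityʳ A))))
bernoulli A (suc j) = begin
    A * A ^ j * (A + suc j)
  ≡⟨ expand A (A ^ j) j ⟩
    A * (A ^ j * (A + j)) + A * A ^ j
  ≤⟨ +-mono-≤ (*-monoʳ-≤ A (bernoulli A j)) (*-monoʳ-≤ A (^-monoˡ-≤ j (n≤1+n A))) ⟩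
    A * (A * suc A ^ j) + A * suc A ^ j
  ≡⟨ collect A (suc A ^ j) ⟩
    A * (suc A * suc A ^ j)
  ∎
  where
  open ≤-Reasoning
  expand : ∀ A P j → A * P * (A + suc j) ≡ A * (P * (A + j)) + A * P
  expand = solve-∀
  collect : ∀ A Q → A * (A * Q) + A * Q ≡ A * (suc A * Q)
  collect = solve-∀

geometric-beats-constant : ∀ A C j → .{{NonZero A}} → A * C ≤ j → A ^ j * C < suc A ^ j
geometric-beats-constant A C j AC≤j = *-cancelˡ-< A (A ^ j * C) (suc A ^ j) (begin-strict
    A * (A ^ j * C)   ≡⟨ swap A (A ^ j) C ⟩
    A ^ j * (A * C)   ≤⟨ *-monoʳ-≤ (A ^ j) AC≤j ⟩
    A ^ j * j         <⟨ *-monoʳ-< (A ^ j) {{m^n≢0 A j}} (m<n+m j (>-nonZero⁻¹ A)) ⟩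
    A ^ j * (A + j)   ≤⟨ bernoulli A j ⟩
    A * suc A ^ j     ∎)
  where
  open ≤-Reasoning
  swap : ∀ A P C → A * (P * C) ≡ P * (A * C)
  swap = solve-∀

succ-pow-bound : ∀ m q → 1 ≤ m → m * suc m ^ q ≤ m * m ^ q + q * 2 ^ q * m ^ q
succ-pow-bound m zero    _   = m≤m+n (m * 1) 0
succ-pow-bound m (suc q) m≥1 = begin
    m * (suc m * S)                   ≡⟨ swap m (suc m) S ⟩
    suc m * (m * S)                   ≤⟨ *-monoʳ-≤ (suc m) (succ-pow-bound m q m≥1) ⟩
    suc m * (m * Y + Q * Y)           ≡⟨ expand m Y Q ⟩
    m * X + (X + Q * X + Q * Y)
      ≤⟨ +-monoʳ-≤ (m * X) (+-mono-≤ (+-monoˡ-≤ (Q * X) X≤2PX) (*-monoʳ-≤ Q Y≤X)) ⟩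
    m * X + (2 * P * X + Q * X + Q * X) ≡⟨ cong (m * X +_) (collect X P q) ⟩
    m * X + suc q * (2 * P) * X       ∎
  where
  open ≤-Reasoning
  S = suc m ^ q
  Y = m ^ q
  X = m * Y
  P = 2 ^ q
  Q = q * P
  Y≤X : Y ≤ X
  Y≤X = m≤n*m Y m {{>-nonZero m≥1}}
  X≤2PX : X ≤ 2 * P * X
  X≤2PX = m≤n*m X (2 * P) {{m*n≢0 2 P {{_}} {{m^n≢0 2 q}}}}
  swap : ∀ m s S → m * (s * S) ≡ s * (m * S)
  swap = solve-∀
  expand : ∀ m Y Q → suc m * (m * Y + Q * Y) ≡ m * (m * Y) + (m * Y + Q * (m * Y) + Q * Y)
  expand = solve-∀
  collect : ∀ X P q → 2 * P * X + q * P * X + q * P * X ≡ suc q * (2 * P) * X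
  collect = solve-∀

pow-ratio : ∀ T q m → 1 ≤ m → 2 * T * (q * 2 ^ q) ≤ m → 2 * T * suc m ^ q ≤ suc (2 * T) * m ^ q
pow-ratio T q m m≥1 large = *-cancelˡ-≤ m {{>-nonZero m≥1}} (begin
    m * (2 * T * suc m ^ q)                                ≡⟨ swap m (2 * T) (suc m ^ q) ⟩
    2 * T * (m * suc m ^ q)                                ≤⟨ *-monoʳ-≤ (2 * T) (succ-pow-bound m q m≥1) ⟩
    2 * T * (m * m ^ q + q * 2 ^ q * m ^ q)                ≡⟨ expand (2 * T) m (m ^ q) (q * 2 ^ q) ⟩
    2 * T * (m * m ^ q) + 2 * T * (q * 2 ^ q) * m ^ q
      ≤⟨ +-monoʳ-≤ (2 * T * (m * m ^ q)) (*-monoˡ-≤ (m ^ q) large) ⟩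
    2 * T * (m * m ^ q) + m * m ^ q                        ≡⟨ collect T m (m ^ q) ⟩
    m * (suc (2 * T) * m ^ q)                              ∎)
  where
  open ≤-Reasoning
  swap : ∀ m U S → m * (U * S) ≡ U * (m * S)
  swap = solve-∀
  expand : ∀ U m Y Q → U * (m * Y + Q * Y) ≡ U * (m * Y) + U * Q * Y
  expand = solve-∀
  collect : ∀ T m Y → 2 * T * (m * Y) + m * Y ≡ m * (suc (2 * T) * Y)
  collect = solve-∀

module Polynomial-times-geometric (T K q : ℕ) where

  h : ℕ → ℕ
  h l = T ^ l * (K + l) ^ q

  -- Beyond this threshold for K + l, pow-ratio applies.
  threshold : ℕ
  threshold = suc (2 * T * (q * 2 ^ q))

  decay-step : ∀ l → threshold ≤ K + l → 2 * h (suc l) ≤ suc (2 * T) * h l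
  decay-step l large = begin
      2 * (T * T ^ l * (K + suc l) ^ q)     ≡⟨ cong (λ v → 2 * (T * T ^ l * v ^ q)) (+-suc K l) ⟩
      2 * (T * T ^ l * suc (K + l) ^ q)     ≡⟨ regroup T (T ^ l) (suc (K + l) ^ q) ⟩
      T ^ l * (2 * T * suc (K + l) ^ q)
        ≤⟨ *-monoʳ-≤ (T ^ l) (pow-ratio T q (K + l) (≤-trans (s≤s z≤n) large) (≤-trans (n≤1+n _) large)) ⟩
      T ^ l * (suc (2 * T) * (K + l) ^ q)   ≡⟨ swap (suc (2 * T)) (T ^ l) ((K + l) ^ q) ⟩
      suc (2 * T) * h l                     ∎
    where
    open ≤-Reasoning
    regroup : ∀ T L W → 2 * (T * L * W) ≡ L * (2 * T * W)
    regroup = solve-∀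
    swap : ∀ A L V → L * (A * V) ≡ A * (L * V)
    swap = solve-∀

  decay : ∀ N j → threshold ≤ K + N → 2 ^ j * h (N + j) ≤ suc (2 * T) ^ j * h N
  decay N zero    _     = ≤-reflexive (cong (λ v → 1 * h v) (+-identityʳ N))
  decay N (suc j) large = begin
      2 * 2 ^ j * h (N + suc j)             ≡⟨ cong (λ v → 2 * 2 ^ j * h v) (+-suc N j) ⟩
      2 * 2 ^ j * h (suc (N + j))           ≡⟨ swap (2 ^ j) (h (suc (N + j))) ⟩
      2 ^ j * (2 * h (suc (N + j)))
        ≤⟨ *-monoʳ-≤ (2 ^ j) (decay-step (N + j) (≤-trans large (≤-trans (m≤m+n (K + N) j) (≤-reflexive (+-assoc K N j))))) ⟩
      2 ^ j * (A * h (N + j))               ≡⟨ exchange (2 ^ j) A (h (N + j)) ⟩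
      A * (2 ^ j * h (N + j))               ≤⟨ *-monoʳ-≤ A (decay N j large) ⟩
      A * (A ^ j * h N)                     ≡⟨ *-assoc A (A ^ j) (h N) ⟨
      A * A ^ j * h N                       ∎
    where
    open ≤-Reasoning
    A = suc (2 * T)
    swap : ∀ P H → 2 * P * H ≡ P * (2 * H)
    swap = solve-∀
    exchange : ∀ x y z → x * (y * z) ≡ y * (x * z)
    exchange = solve-∀

  eventually-below : Σ ℕ λ N → ∀ l → N ≤ l → h l < suc T ^ l
  eventually-below = threshold + A * h threshold , below
    where
    A = suc (2 * T)
    double : suc A ≡ 2 * suc T
    double = sym (*-suc 2 T)
    below : ∀ l → threshold + A * h threshold ≤ l → h l < suc T ^ l
    below l large with m≤n⇒∃[o]m+o≡n (≤-trans (m≤m+n threshold (A * h threshold)) large)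
    ... | j , refl = *-cancelˡ-< (2 ^ j) (h l) (suc T ^ l) (begin-strict
        2 ^ j * h (threshold + j)  ≤⟨ decay threshold j (m≤n+m threshold K) ⟩
        A ^ j * h threshold        <⟨ geometric-beats-constant A (h threshold) j AC≤j ⟩
        suc A ^ j                  ≡⟨ trans (cong (_^ j) double) (^-distribʳ-* 2 (suc T) j) ⟩
        2 ^ j * suc T ^ j          ≤⟨ *-monoʳ-≤ (2 ^ j) (^-monoʳ-≤ (suc T) (m≤n+m j threshold)) ⟩
        2 ^ j * suc T ^ l          ∎)
      where
      open ≤-Reasoning
      AC≤j : A * h threshold ≤ j
      AC≤j = +-cancelˡ-≤ threshold (A * h threshold) j large

-- Infinitely many good pairs include ones with arbitrarily large l: since r < l,
-- only finitely many pairs (those in [0,N)²) have l < N.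
large-good-pair : ∀ a p q → InfinitelyManyGoodPairs a p q → ∀ N
                → ∃ λ r → ∃ λ l → GoodPair a p q (r , l) × N ≤ l
large-good-pair a p q many N with many (cartesianProduct (upTo N) (upTo N))
... | (r , l) , good@(_ , r<l , _) , fresh with l <? N
...   | yes l<N = ⊥-elim (fresh (∈-cartesianProduct⁺ (∈-upTo⁺ (<-trans r<l l<N)) (∈-upTo⁺ l<N)))
...   | no  l≮N = r , l , good , ≮⇒≥ l≮N

power-squeeze : ∀ p q l B K → 3 ^ q < 2 ^ p → l * p < q * B → 2 ^ B ≤ 3 ^ l * K
              → suc (3 ^ q) ^ l < (3 ^ q) ^ l * K ^ q
power-squeeze p q l B K 3^q<2^p lp<qB 2^B≤3^lK = begin-strict
    suc (3 ^ q) ^ l       ≤⟨ ^-monoˡ-≤ l 3^q<2^p ⟩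
    (2 ^ p) ^ l           ≡⟨ trans (^-*-assoc 2 p l) (cong (2 ^_) (*-comm p l)) ⟩
    2 ^ (l * p)           <⟨ ^-monoʳ-< 2 (s≤s (s≤s z≤n)) lp<qB ⟩
    2 ^ (q * B)           ≡⟨ trans (cong (2 ^_) (*-comm q B)) (sym (^-*-assoc 2 B q)) ⟩
    (2 ^ B) ^ q           ≤⟨ ^-monoˡ-≤ q 2^B≤3^lK ⟩
    (3 ^ l * K) ^ q       ≡⟨ ^-distribʳ-* (3 ^ l) K q ⟩
    (3 ^ l) ^ q * K ^ q   ≡⟨ cong (_* K ^ q) 3^lq≡3^ql ⟩
    (3 ^ q) ^ l * K ^ q   ∎
  where
  open ≤-Reasoning
  3^lq≡3^ql : (3 ^ l) ^ q ≡ (3 ^ q) ^ l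
  3^lq≡3^ql = trans (^-*-assoc 3 l q) (trans (cong (3 ^_) (*-comm l q)) (sym (^-*-assoc 3 q l)))

-- Were a the E-sequence of x, a good pair with l past the bound of step (4)
-- would violate that bound by steps (2) and (3).
theorem4p13 : (a : ℕ → ℕ) → IsESequence a
    → (∀ n → 1 ≤ n → 2 ^ b a n < 3 ^ n)
    → (Σ ℕ λ p → Σ ℕ λ q → (1 ≤ q) × (3 ^ q < 2 ^ p) × InfinitelyManyGoodPairs a p q)
    → ΩDivergent a
theorem4p13 a _ subcritical (p , q , _ , 3^q<2^p , many) (x , x≥1 , _ , x-orbit)
  with Polynomial-times-geometric.eventually-below (3 ^ q) x q
... | N , below with large-good-pair a p q many N
... | r , l , (r≥1 , r<l , lp<qB , rep) , N≤l =
  <-asym (below l N≤l) (power-squeeze p q l (b a (l + r)) (x + l) 3^q<2^p lp<qB window)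
  where
  exact : ∀ n → ExactSteps a x n
  exact n k _ = proj₁ (x-orbit k)
  subcritical-≤ : ∀ k → 2 ^ b a k ≤ 3 ^ k
  subcritical-≤ zero    = ≤-refl
  subcritical-≤ (suc k) = <⇒≤ (subcritical (suc k) (s≤s z≤n))
  window : 2 ^ b a (l + r) ≤ 3 ^ l * (x + l)
  window = window-bound a x l r exact subcritical-≤
             (subcritical l (≤-trans r≥1 (<⇒≤ r<l))) x≥1 rep
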